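{- Let $k\ge 2$ be a fixed integer. Suppose $G$ is a $k$-partite graph with parts $Z_1,\dots,Z_k$, where $|Z_i|=n$ for each $i\in[k]$. Let $0<\gamma<1$, let $c>0$ with $c\gg 1/\log n$, and let $t\ge 2$ be a fixed integer. If $|N(v,Z_i)|\ge \gamma n$ for every $v\in Z_k$ and every $i\in[k-1]$, then there exists $S\subseteq Z_k$ with $|S|=\frac12 n^{1-c}$ such that every $t$-subset $T\in\binom{S}{t}$ satisfies $|N(T,Z_i)|\ge \gamma^{\frac{2(k-1)(t+1)}{c}} n$ for each $i\in[k-1]$.
   Context: For vertex sets $A,B$, $N(A,B)$ denotes the set of common neighbours of all vertices of $A$ lying in $B$, and $N(v,B)=N(\{v\},B)$. Logarithms are base 2. Floors and ceilings are ignored.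
   Formalization: The parameters γ and c range over the rationals rather than the reals. -}

module Defs where

open import Data.Nat using (ℕ; zero; suc)
open import Data.Bool using (Bool; true; false; _∧_; not; _∨_)
open import Data.Fin using (Fin; zero; suc; fromℕ; inject₁)
open import Data.Fin.Subset using (Subset)
open import Data.Vec using (tabulate; lookup)
open import Data.Integer using (+_)
open import Data.Rational using (ℚ; _/_; _*_; 1ℚ)
open import Relation.Binary.PropositionalEquality using (_≡_)

ℕ→ℚ : ℕ → ℚ
ℕ→ℚ n = (+ n) / 1

_^ℚ_ : ℚ → ℕ → ℚ
x ^ℚ zero = 1ℚ
x ^ℚ suc e = x * (x ^ℚ e)

allFin : {n : ℕ} → (Fin n → Bool) → Bool
allFin {zero} f = true
allFin {suc n} f = f zero ∧ allFin (λ x → f (suc x))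

-- A k-partite graph with parts Z_1..Z_k (indexed by Fin k), each of size n.
-- Vertex (i , x) is the x-th vertex of part Z_i.  Edges are symmetric and
-- there are no edges inside a part.
record KPartite (k n : ℕ) : Set where
  field
    adj   : Fin k → Fin n → Fin k → Fin n → Bool
    sym   : ∀ i x j y → adj i x j y ≡ adj j y i x
    indep : ∀ i x y → adj i x i y ≡ false

open KPartite public

lastPart : (m : ℕ) → Fin (suc m)
lastPart m = fromℕ m

-- N(T, Z_i) for T ⊆ Z_k (the last part): common neighbours in Z_i
-- of all vertices of T.
N : {m n : ℕ} → KPartite (suc m) n → Subset n → Fin (suc m) → Subset n
N {m} G T i = tabulate λ y →
  allFin (λ x → not (lookup T x) ∨ adj G (lastPart m) x i y)

-- Dependent random choice, derandomised by averaging.  Write γ = a / b.  For one part Zᵢ and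
-- S ⊆ Z_k, consider the sets R = S ∩ N(y₁) ∩ … ∩ N(y_s) for all s-tuples of vertices of Zᵢ.  By
-- the degree condition Σ |R| ≥ (γ n) ^ s |S|, whereas a t-set T with |N(T, Zᵢ)| < γ ^ r n lies in
-- fewer than (γ ^ r n) ^ s of them.  Hence, if 2 n ^ (t - 1) γ ^ ((r - 1) s) ≤ 1, some R has
-- |R| - #bad(R) ≥ γ ^ s |S| / 2, and deleting a vertex of every bad t-set of R leaves a set all of
-- whose t-sets are good.  Cleaning the k - 1 parts one after the other, starting from Z_k, leaves
-- (γ ^ s / 2) ^ (k - 1) n vertices.  With c = p / q take r = ⌊2 (k - 1) (t + 1) / c⌋ and s maximal
-- with (2 / γ ^ s) ^ (k - 1) ≤ n ^ c: the maximality of s gives the condition above, and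
-- 2 ^ (C q) ≤ n ^ p makes s > a.  If c ≥ 1, a single vertex will do.

module Submission where

open import Defs using (KPartite; adj; lastPart; N; allFin; ℕ→ℚ; _^ℚ_)
open import Data.Nat using (ℕ; zero; suc; _+_; _*_; _^_; _≤_; _<_; z≤n; s≤s; NonZero; >-nonZero)
import Data.Nat.Properties as ℕ
open import Data.Nat.DivMod using (_/_; _%_; m/n*n≤m; m%n<n; m≡m%n+[m/n]*n)
open import Data.Nat.Coprimality using (1-coprimeTo) renaming (sym to coprime-sym)
open import Data.Nat.Tactic.RingSolver using (solve-∀)
open import Data.Bool using (Bool; true; false; _∨_; not; if_then_else_)
open import Data.Bool.Properties using (∧-zeroʳ)
open import Data.Fin as Fin using (Fin; zero; suc; inject₁)
open import Data.Fin.Subset using (Subset; outside; inside; ∣_∣; _∈_; _∉_; _⊆_; _∩_; _-_; ⁅_⁆; ⊤; Nonempty)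
open import Data.Fin.Subset.Properties
  using (_∈?_; _⊆?_; ∩⇔×; ⊆-trans; p─q⊆p; p─⊥≡p; p∩q⊆p; p∩q⊆q; x∈p∩q⁺; ∣p∣≤n; x∈⁅x⁆; x∈⁅y⁆⇒x≡y; ∣⁅x⁆∣≡1; ∣⊤∣≡n; p⊆q⇒∣p∣≤∣q∣)
open import Data.Vec using ([]; _∷_; here; there; lookup; tabulate)
open import Data.Vec.Properties using (lookup∘tabulate; []=⇒lookup; lookup⇒[]=)
import Data.Integer.Properties as ℤ
open import Data.Rational using (ℚ; mkℚ; toℚᵘ; 0ℚ; 1ℚ; *<*) renaming (_*_ to _*ℚ_; _≤_ to _≤ℚ_; _<_ to _<ℚ_)
import Data.Rational.Properties as Q
open import Data.Rational.Unnormalised using (mkℚᵘ; *≤*) renaming (_≃_ to _≃ᵘ_; _≤_ to _≤ᵘ_)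
import Data.Rational.Unnormalised.Properties as Qᵘ
open import Data.Product using (∃-syntax; _×_; _,_)
open import Function using (_∘_; _⇔_; Equivalence; mk⇔; case_of_)
open import Function.Properties.Equivalence using () renaming (sym to ⇔-sym; trans to ⇔-trans)
open import Relation.Binary.PropositionalEquality
open import Relation.Nullary using (Dec; does; yes; no; ¬_; contradiction)
open import Relation.Nullary.Decidable using (_×-dec_)
open import Relation.Unary using (Decidable)
open import Algebra.Properties.CommutativeSemigroup ℕ.*-commutativeSemigroup
  using (xy∙z≈y∙xz; x∙yz≈y∙xz; x∙yz≈yx∙z) renaming (interchange to *-interchange)
open import Algebra.Properties.Semiring.Sum ℕ.+-*-semiring
  using (sum; sum-cong-≗; ∑-distrib-+; ∑-comm; *-distribˡ-sum)

^-distribʳ-* : ∀ m n o → (m * n) ^ o ≡ m ^ o * n ^ o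
^-distribʳ-* m n zero    = refl
^-distribʳ-* m n (suc o) = begin
  m * n * (m * n) ^ o      ≡⟨ cong (m * n *_) (^-distribʳ-* m n o) ⟩
  m * n * (m ^ o * n ^ o)  ≡⟨ *-interchange m n (m ^ o) (n ^ o) ⟩
  m * m ^ o * (n * n ^ o)  ∎
  where open ≡-Reasoning

^-bernoulli : ∀ a k → a ^ k * (a + k) ≤ a * suc a ^ k
^-bernoulli a zero    = ℕ.≤-reflexive (trans (ℕ.+-identityʳ (a + 0)) (trans (ℕ.+-identityʳ a) (sym (ℕ.*-identityʳ a))))
^-bernoulli a (suc k) = begin
  a * a ^ k * (a + suc k)              ≤⟨ ℕ.m≤m+n _ (a ^ k * k) ⟩
  a * a ^ k * (a + suc k) + a ^ k * k  ≡⟨ e₁ a (a ^ k) k ⟩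
  suc a * (a ^ k * (a + k))            ≤⟨ ℕ.*-monoʳ-≤ (suc a) (^-bernoulli a k) ⟩
  suc a * (a * suc a ^ k)              ≡⟨ e₂ a (suc a ^ k) ⟩
  a * (suc a * suc a ^ k)              ∎
  where
  open ℕ.≤-Reasoning
  e₁ : ∀ a x k → a * x * (a + suc k) + x * k ≡ suc a * (x * (a + k))
  e₁ = solve-∀
  e₂ : ∀ a x → suc a * (a * x) ≡ a * (suc a * x)
  e₂ = solve-∀

k<2^k : ∀ k → k < 2 ^ k
k<2^k k = subst₂ _≤_ (trans (cong (_* suc k) (ℕ.^-zeroˡ k)) (ℕ.*-identityˡ (suc k))) (ℕ.+-identityʳ (2 ^ k)) (^-bernoulli 1 k)

2^k≤n^p⇒n>0 : ∀ k {n p} → 0 < p → 2 ^ k ≤ n ^ p → 0 < n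
2^k≤n^p⇒n>0 k {zero}  {suc p} _ 2^k≤0 = contradiction 2^k≤0 (ℕ.<⇒≱ (ℕ.m^n>0 2 k))
2^k≤n^p⇒n>0 k {suc n}         _ _     = s≤s z≤n

lastTrue : ∀ {P : ℕ → Set} → Decidable P → ∀ {s₀} k → P s₀ → ¬ P (s₀ + k) → ∃[ s ] s₀ ≤ s × P s × ¬ P (suc s)
lastTrue {P} P? {s₀} zero    Ps₀ ¬Ps₀+0 = contradiction (subst P (sym (ℕ.+-identityʳ s₀)) Ps₀) ¬Ps₀+0
lastTrue {P} P? {s₀} (suc k) Ps₀ ¬Ps₀+1+k with P? (suc s₀)
... | no ¬Ps₀+1 = s₀ , ℕ.≤-refl , Ps₀ , ¬Ps₀+1
... | yes Ps₀+1 = let s , s₀<s , Ps , ¬Ps+1 = lastTrue P? k Ps₀+1 (subst (¬_ ∘ P) (ℕ.+-suc s₀ k) ¬Ps₀+1+k)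
                  in s , ℕ.<⇒≤ s₀<s , Ps , ¬Ps+1

𝟙 : ∀ {a} {P : Set a} → Dec P → ℕ
𝟙 P? = if does P? then 1 else 0

𝟙-× : ∀ {a b} {P : Set a} {Q : Set b} (p : Dec P) (q : Dec Q) → 𝟙 (p ×-dec q) ≡ 𝟙 p * 𝟙 q
𝟙-× (yes _) (yes _) = refl
𝟙-× (yes _) (no _)  = refl
𝟙-× (no _)  _       = refl

𝟙-mono : ∀ {a b} {P : Set a} {Q : Set b} (p : Dec P) (q : Dec Q) → (P → Q) → 𝟙 p ≤ 𝟙 q
𝟙-mono (yes P) (yes _) _   = ℕ.≤-refl
𝟙-mono (yes P) (no ¬Q) P⇒Q = contradiction (P⇒Q P) ¬Q
𝟙-mono (no _)  _       _   = z≤n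

𝟙-⇔ : ∀ {a b} {P : Set a} {Q : Set b} (p : Dec P) (q : Dec Q) → P ⇔ Q → 𝟙 p ≡ 𝟙 q
𝟙-⇔ p q P⇔Q = ℕ.≤-antisym (𝟙-mono p q (Equivalence.to P⇔Q)) (𝟙-mono q p (Equivalence.from P⇔Q))

𝟙-yes : ∀ {a} {P : Set a} (p : Dec P) → P → 𝟙 p ≡ 1
𝟙-yes (yes _) _ = refl
𝟙-yes (no ¬P) P = contradiction P ¬P

𝟙-no : ∀ {a} {P : Set a} (p : Dec P) → ¬ P → 𝟙 p ≡ 0
𝟙-no (yes P) ¬P = contradiction P ¬P
𝟙-no (no _)  _  = refl

𝟙>0⇒ : ∀ {a} {P : Set a} (p : Dec P) → 0 < 𝟙 p → P
𝟙>0⇒ (yes P) _ = P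

𝟙*-mono-≤ : ∀ {a} {P : Set a} (p : Dec P) {x y} → (P → x ≤ y) → 𝟙 p * x ≤ 𝟙 p * y
𝟙*-mono-≤ (yes P) P⇒x≤y = ℕ.+-mono-≤ (P⇒x≤y P) z≤n
𝟙*-mono-≤ (no _)  _     = z≤n

∑-mono-≤ : ∀ {n} {f g : Fin n → ℕ} → (∀ i → f i ≤ g i) → sum f ≤ sum g
∑-mono-≤ {zero}  _   = z≤n
∑-mono-≤ {suc n} f≤g = ℕ.+-mono-≤ (f≤g zero) (∑-mono-≤ (f≤g ∘ suc))

∑-const : ∀ n c → sum {n} (λ _ → c) ≡ n * c
∑-const zero    c = refl
∑-const (suc n) c = cong (c +_) (∑-const n c)

∑≤∑⇒∃≤ : ∀ {n} → 0 < n → (f g : Fin n → ℕ) → sum f ≤ sum g → ∃[ i ] f i ≤ g i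
∑≤∑⇒∃≤ {suc n} _ f g ∑f≤∑g with f zero ℕ.≤? g zero
... | yes f₀≤g₀ = zero , f₀≤g₀
∑≤∑⇒∃≤ {suc zero}    _ f g ∑f≤∑g | no f₀≰g₀ =
  contradiction (subst₂ _≤_ (ℕ.+-identityʳ _) (ℕ.+-identityʳ _) ∑f≤∑g) f₀≰g₀
∑≤∑⇒∃≤ {suc (suc n)} _ f g ∑f≤∑g | no f₀≰g₀ =
  let i , fi≤gi = ∑≤∑⇒∃≤ (s≤s z≤n) (f ∘ suc) (g ∘ suc)
        (ℕ.+-cancelˡ-≤ (g zero) _ _ (ℕ.≤-trans (ℕ.+-monoˡ-≤ _ (ℕ.<⇒≤ (ℕ.≰⇒> f₀≰g₀))) ∑f≤∑g))
  in suc i , fi≤gi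

∑ₛ : ∀ {n} → (Subset n → ℕ) → ℕ
∑ₛ {zero}  f = f []
∑ₛ {suc n} f = ∑ₛ (f ∘ (outside ∷_)) + ∑ₛ (f ∘ (inside ∷_))

∑ₛ-cong : ∀ {n} {f g : Subset n → ℕ} → (∀ T → f T ≡ g T) → ∑ₛ f ≡ ∑ₛ g
∑ₛ-cong {zero}  f≗g = f≗g []
∑ₛ-cong {suc n} f≗g = cong₂ _+_ (∑ₛ-cong (f≗g ∘ (outside ∷_))) (∑ₛ-cong (f≗g ∘ (inside ∷_)))

∑ₛ-mono-≤ : ∀ {n} {f g : Subset n → ℕ} → (∀ T → f T ≤ g T) → ∑ₛ f ≤ ∑ₛ g
∑ₛ-mono-≤ {zero}  f≤g = f≤g []
∑ₛ-mono-≤ {suc n} f≤g = ℕ.+-mono-≤ (∑ₛ-mono-≤ (f≤g ∘ (outside ∷_))) (∑ₛ-mono-≤ (f≤g ∘ (inside ∷_)))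

∑ₛ-mono-< : ∀ {n} {f g : Subset n → ℕ} → (∀ T → f T ≤ g T) → ∀ T → f T < g T → ∑ₛ f < ∑ₛ g
∑ₛ-mono-< {zero}  f≤g []             fT<gT = fT<gT
∑ₛ-mono-< {suc n} f≤g (outside ∷ T) fT<gT =
  ℕ.+-mono-<-≤ (∑ₛ-mono-< (f≤g ∘ (outside ∷_)) T fT<gT) (∑ₛ-mono-≤ (f≤g ∘ (inside ∷_)))
∑ₛ-mono-< {suc n} f≤g (inside ∷ T)  fT<gT =
  ℕ.+-mono-≤-< (∑ₛ-mono-≤ (f≤g ∘ (outside ∷_))) (∑ₛ-mono-< (f≤g ∘ (inside ∷_)) T fT<gT)

∑ₛ-*ˡ : ∀ {n} c (f : Subset n → ℕ) → ∑ₛ (λ T → c * f T) ≡ c * ∑ₛ f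
∑ₛ-*ˡ {zero}  c f = refl
∑ₛ-*ˡ {suc n} c f = begin
  ∑ₛ (λ T → c * f (outside ∷ T)) + ∑ₛ (λ T → c * f (inside ∷ T))
    ≡⟨ cong₂ _+_ (∑ₛ-*ˡ c (f ∘ (outside ∷_))) (∑ₛ-*ˡ c (f ∘ (inside ∷_))) ⟩
  c * ∑ₛ (f ∘ (outside ∷_)) + c * ∑ₛ (f ∘ (inside ∷_))
    ≡⟨ ℕ.*-distribˡ-+ c _ _ ⟨
  c * ∑ₛ f ∎
  where open ≡-Reasoning

term≤∑ₛ : ∀ {n} (f : Subset n → ℕ) T → f T ≤ ∑ₛ f
term≤∑ₛ {zero}  f []            = ℕ.≤-refl
term≤∑ₛ {suc n} f (outside ∷ T) = ℕ.≤-trans (term≤∑ₛ (f ∘ (outside ∷_)) T) (ℕ.m≤m+n _ _)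
term≤∑ₛ {suc n} f (inside ∷ T)  = ℕ.≤-trans (term≤∑ₛ (f ∘ (inside ∷_)) T) (ℕ.m≤n+m _ _)

∑ₛ>0⇒∃ : ∀ {n} (f : Subset n → ℕ) → 0 < ∑ₛ f → ∃[ T ] 0 < f T
∑ₛ>0⇒∃ {zero}  f ∑f>0 = [] , ∑f>0
∑ₛ>0⇒∃ {suc n} f ∑f>0 with ∑ₛ (f ∘ (outside ∷_)) in eq
... | suc _ = let T , fT>0 = ∑ₛ>0⇒∃ (f ∘ (outside ∷_)) (subst (0 <_) (sym eq) (s≤s z≤n)) in outside ∷ T , fT>0
... | zero  = let T , fT>0 = ∑ₛ>0⇒∃ (f ∘ (inside ∷_)) ∑f>0 in inside ∷ T , fT>0

∑ₛ-zero : ∀ n → ∑ₛ {n} (λ _ → 0) ≡ 0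
∑ₛ-zero zero    = refl
∑ₛ-zero (suc n) = cong₂ _+_ (∑ₛ-zero n) (∑ₛ-zero n)

∑-∑ₛ-comm : ∀ {ℓ n} (f : Fin ℓ → Subset n → ℕ) → sum (λ y → ∑ₛ (f y)) ≡ ∑ₛ (λ T → sum (λ y → f y T))
∑-∑ₛ-comm {n = zero}  f = refl
∑-∑ₛ-comm {n = suc n} f = trans
  (∑-distrib-+ (λ y → ∑ₛ (f y ∘ (outside ∷_))) (λ y → ∑ₛ (f y ∘ (inside ∷_))))
  (cong₂ _+_ (∑-∑ₛ-comm (λ y → f y ∘ (outside ∷_))) (∑-∑ₛ-comm (λ y → f y ∘ (inside ∷_))))

∣p∣≡∑∈ : ∀ {n} (p : Subset n) → ∣ p ∣ ≡ sum (λ x → 𝟙 (x ∈? p))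
∣p∣≡∑∈ []            = refl
∣p∣≡∑∈ (inside ∷ p)  = cong suc (∣p∣≡∑∈ p)
∣p∣≡∑∈ (outside ∷ p) = ∣p∣≡∑∈ p

𝟙-∈∩ : ∀ {n} (x : Fin n) (p q : Subset n) → 𝟙 (x ∈? p ∩ q) ≡ 𝟙 (x ∈? p) * 𝟙 (x ∈? q)
𝟙-∈∩ x p q = trans (𝟙-⇔ (x ∈? p ∩ q) (x ∈? p ×-dec x ∈? q) ∩⇔×) (𝟙-× (x ∈? p) (x ∈? q))

allFin≡true⇔ : ∀ {n} (f : Fin n → Bool) → allFin f ≡ true ⇔ (∀ x → f x ≡ true)
allFin≡true⇔ f = mk⇔ (to f) (from f)
  where
  to : ∀ {n} (f : Fin n → Bool) → allFin f ≡ true → ∀ x → f x ≡ true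
  to {zero}  f all ()
  to {suc n} f all with f zero in f₀
  ... | true = λ { zero → f₀ ; (suc x) → to (f ∘ suc) all x }
  from : ∀ {n} (f : Fin n → Bool) → (∀ x → f x ≡ true) → allFin f ≡ true
  from {zero}  f _   = refl
  from {suc n} f all rewrite all zero = from (f ∘ suc) (all ∘ suc)

∈tabulate⇔ : ∀ {n} (f : Fin n → Bool) {x} → x ∈ tabulate f ⇔ f x ≡ true
∈tabulate⇔ f {x} = mk⇔
  (λ x∈ → trans (sym (lookup∘tabulate f x)) ([]=⇒lookup x∈))
  (λ fx → lookup⇒[]= x (tabulate f) (trans (lookup∘tabulate f x) fx))

⁅x⁆⊆p⇔x∈p : ∀ {n} {x : Fin n} {p} → ⁅ x ⁆ ⊆ p ⇔ x ∈ p
⁅x⁆⊆p⇔x∈p {x = x} = mk⇔ (λ ⁅x⁆⊆p → ⁅x⁆⊆p (x∈⁅x⁆ x)) (λ x∈p {y} y∈⁅x⁆ → subst (_∈ _) (sym (x∈⁅y⁆⇒x≡y x y∈⁅x⁆)) x∈p)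

x∉p-x : ∀ {n} (x : Fin n) (p : Subset n) → x ∉ p - x
x∉p-x zero    (s ∷ p) ()
x∉p-x (suc x) (s ∷ p) (there x∈p-x) = x∉p-x x p x∈p-x

∣p∣≤1+∣p-x∣ : ∀ {n} (x : Fin n) (p : Subset n) → ∣ p ∣ ≤ suc ∣ p - x ∣
∣p∣≤1+∣p-x∣ zero    (outside ∷ p) = ℕ.≤-trans (ℕ.≤-reflexive (cong ∣_∣ (sym (p─⊥≡p p)))) (ℕ.n≤1+n _)
∣p∣≤1+∣p-x∣ zero    (inside ∷ p)  = s≤s (ℕ.≤-reflexive (cong ∣_∣ (sym (p─⊥≡p p))))
∣p∣≤1+∣p-x∣ (suc x) (outside ∷ p) = ∣p∣≤1+∣p-x∣ x p
∣p∣≤1+∣p-x∣ (suc x) (inside ∷ p)  = s≤s (∣p∣≤1+∣p-x∣ x p)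

∣p∣>0⇒Nonempty : ∀ {n} (p : Subset n) → 0 < ∣ p ∣ → Nonempty p
∣p∣>0⇒Nonempty (inside ∷ p)  _      = zero , here
∣p∣>0⇒Nonempty (outside ∷ p) ∣p∣>0 = let x , x∈p = ∣p∣>0⇒Nonempty p ∣p∣>0 in suc x , there x∈p

#subsetsOfSize : ∀ {n} → Subset n → ℕ → ℕ
#subsetsOfSize S t = ∑ₛ λ T → 𝟙 (T ⊆? S ×-dec ∣ T ∣ ℕ.≟ t)

#subsetsOfSize≤∣S∣^t : ∀ {n} (S : Subset n) t → #subsetsOfSize S t ≤ ∣ S ∣ ^ t
#subsetsOfSize≤∣S∣^t []            zero    = ℕ.≤-refl
#subsetsOfSize≤∣S∣^t []            (suc t) = z≤n
#subsetsOfSize≤∣S∣^t {suc n} (outside ∷ S) t =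
  subst (_≤ ∣ S ∣ ^ t) (sym (trans (cong (#subsetsOfSize S t +_) (∑ₛ-zero n)) (ℕ.+-identityʳ _)))
    (#subsetsOfSize≤∣S∣^t S t)
#subsetsOfSize≤∣S∣^t {suc n} (inside ∷ S) zero =
  subst (_≤ 1) (sym (trans (cong (#subsetsOfSize S 0 +_) noneOfSize1+) (ℕ.+-identityʳ _)))
    (#subsetsOfSize≤∣S∣^t S 0)
  where
  noneOfSize1+ : ∑ₛ (λ T → 𝟙 (T ⊆? S ×-dec suc ∣ T ∣ ℕ.≟ 0)) ≡ 0
  noneOfSize1+ = trans (∑ₛ-cong (λ T → cong (λ b → if b then 1 else 0) (∧-zeroʳ (does (T ⊆? S))))) (∑ₛ-zero n)
#subsetsOfSize≤∣S∣^t (inside ∷ S) (suc t) = begin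
  #subsetsOfSize S (suc t) + #subsetsOfSize S t
    ≤⟨ ℕ.+-mono-≤ (#subsetsOfSize≤∣S∣^t S (suc t)) (#subsetsOfSize≤∣S∣^t S t) ⟩
  ∣ S ∣ * ∣ S ∣ ^ t + ∣ S ∣ ^ t  ≡⟨ ℕ.+-comm (∣ S ∣ * ∣ S ∣ ^ t) _ ⟩
  suc ∣ S ∣ * ∣ S ∣ ^ t          ≤⟨ ℕ.*-monoʳ-≤ (suc ∣ S ∣) (ℕ.^-monoˡ-≤ t (ℕ.n≤1+n _)) ⟩
  suc ∣ S ∣ * suc ∣ S ∣ ^ t      ∎
  where open ℕ.≤-Reasoning

module _ {n} (f : Subset n → ℕ) (shrink : ∀ S → 0 < f S → ∃[ x ] x ∈ S × f (S - x) < f S) where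

  deleteUntilZero : ∀ S → ∃[ S' ] S' ⊆ S × ∣ S ∣ ≤ ∣ S' ∣ + f S × f S' ≡ 0
  deleteUntilZero S = go (f S) S ℕ.≤-refl
    where
    go : ∀ k S → f S ≤ k → ∃[ S' ] S' ⊆ S × ∣ S ∣ ≤ ∣ S' ∣ + f S × f S' ≡ 0
    go k S fS≤k with f S ℕ.≟ 0
    ... | yes fS≡0 = S , (λ x∈S → x∈S) , ℕ.m≤m+n _ _ , fS≡0
    ... | no fS≢0 with shrink S (ℕ.n≢0⇒n>0 fS≢0)
    go zero    S fS≤0    | no fS≢0 | _ = contradiction (ℕ.n≤0⇒n≡0 fS≤0) fS≢0
    go (suc k) S fS≤1+k | no fS≢0 | x , x∈S , f[S-x]<fS =
      let S' , S'⊆S-x , size , fS'≡0 = go k (S - x) (ℕ.≤-pred (ℕ.≤-trans f[S-x]<fS fS≤1+k))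
      in S' , ⊆-trans S'⊆S-x (p─q⊆p S ⁅ x ⁆) , (begin
        ∣ S ∣                      ≤⟨ ∣p∣≤1+∣p-x∣ x S ⟩
        suc ∣ S - x ∣              ≤⟨ s≤s size ⟩
        suc (∣ S' ∣ + f (S - x))   ≡⟨ ℕ.+-suc _ _ ⟨
        ∣ S' ∣ + suc (f (S - x))   ≤⟨ ℕ.+-monoʳ-≤ ∣ S' ∣ f[S-x]<fS ⟩
        ∣ S' ∣ + f S               ∎) , fS'≡0
      where open ℕ.≤-Reasoning

-- Dependent random choice

module Refinements {ℓ n} (ρ : Fin ℓ → Subset n → Subset n) where

  -- ∑ρ s f S adds up f over the ℓ ^ s sets obtained from S by s refinements; averaging over them
  -- replaces the random choice of s vertices.
  ∑ρ : ℕ → (Subset n → ℕ) → Subset n → ℕ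
  ∑ρ zero    f S = f S
  ∑ρ (suc s) f S = sum λ y → ∑ρ s f (ρ y S)

  ∑ρ-+ : ∀ s (f g : Subset n → ℕ) S → ∑ρ s (λ R → f R + g R) S ≡ ∑ρ s f S + ∑ρ s g S
  ∑ρ-+ zero    f g S = refl
  ∑ρ-+ (suc s) f g S = trans (sum-cong-≗ (λ y → ∑ρ-+ s f g (ρ y S))) (∑-distrib-+ (λ y → ∑ρ s f (ρ y S)) (λ y → ∑ρ s g (ρ y S)))

  ∑ρ-*ˡ : ∀ s c (f : Subset n → ℕ) S → ∑ρ s (λ R → c * f R) S ≡ c * ∑ρ s f S
  ∑ρ-*ˡ zero    c f S = refl
  ∑ρ-*ˡ (suc s) c f S = trans (sum-cong-≗ (λ y → ∑ρ-*ˡ s c f (ρ y S))) (sym (*-distribˡ-sum c (λ y → ∑ρ s f (ρ y S))))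

  ∑ρ-const : ∀ s c S → ∑ρ s (λ _ → c) S ≡ ℓ ^ s * c
  ∑ρ-const zero    c S = sym (ℕ.+-identityʳ c)
  ∑ρ-const (suc s) c S = begin
    sum (λ y → ∑ρ s (λ _ → c) (ρ y S)) ≡⟨ sum-cong-≗ (λ y → ∑ρ-const s c (ρ y S)) ⟩
    sum {ℓ} (λ _ → ℓ ^ s * c)          ≡⟨ ∑-const ℓ _ ⟩
    ℓ * (ℓ ^ s * c)                    ≡⟨ ℕ.*-assoc ℓ _ c ⟨
    ℓ ^ suc s * c                      ∎
    where open ≡-Reasoning

  module _ (ρ-⊆ : ∀ y S → ρ y S ⊆ S) (ℓ>0 : 0 < ℓ) where

    ∑ρ≤∑ρ⇒∃≤ : ∀ s (f g : Subset n → ℕ) S → ∑ρ s f S ≤ ∑ρ s g S → ∃[ S' ] S' ⊆ S × f S' ≤ g S'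
    ∑ρ≤∑ρ⇒∃≤ zero    f g S fS≤gS = S , (λ x∈S → x∈S) , fS≤gS
    ∑ρ≤∑ρ⇒∃≤ (suc s) f g S ∑f≤∑g =
      let y , ≤y = ∑≤∑⇒∃≤ ℓ>0 _ _ ∑f≤∑g
          S' , S'⊆ρyS , fS'≤gS' = ∑ρ≤∑ρ⇒∃≤ s f g (ρ y S) ≤y
      in S' , ⊆-trans S'⊆ρyS (ρ-⊆ y S) , fS'≤gS'

  module _ (F : Subset n → ℕ) (u v : ℕ) where

    ∑ρ-lower : (∀ S → u * F S ≤ v * sum (λ y → F (ρ y S))) → ∀ s S → u ^ s * F S ≤ v ^ s * ∑ρ s F S
    ∑ρ-lower step zero    S = ℕ.≤-refl
    ∑ρ-lower step (suc s) S = begin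
      u * u ^ s * F S                         ≡⟨ xy∙z≈y∙xz u (u ^ s) (F S) ⟩
      u ^ s * (u * F S)                       ≤⟨ ℕ.*-monoʳ-≤ (u ^ s) (step S) ⟩
      u ^ s * (v * sum (λ y → F (ρ y S)))     ≡⟨ x∙yz≈y∙xz (u ^ s) v _ ⟩
      v * (u ^ s * sum (λ y → F (ρ y S)))     ≡⟨ cong (v *_) (*-distribˡ-sum (u ^ s) (λ y → F (ρ y S))) ⟩
      v * sum (λ y → u ^ s * F (ρ y S))       ≤⟨ ℕ.*-monoʳ-≤ v (∑-mono-≤ (λ y → ∑ρ-lower step s (ρ y S))) ⟩
      v * sum (λ y → v ^ s * ∑ρ s F (ρ y S))  ≡⟨ cong (v *_) (*-distribˡ-sum (v ^ s) (λ y → ∑ρ s F (ρ y S))) ⟨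
      v * (v ^ s * ∑ρ (suc s) F S)            ≡⟨ ℕ.*-assoc v (v ^ s) _ ⟨
      v * v ^ s * ∑ρ (suc s) F S              ∎
      where open ℕ.≤-Reasoning

    ∑ρ-upper : (∀ S → u * sum (λ y → F (ρ y S)) ≤ v * F S) → ∀ s S → u ^ s * ∑ρ s F S ≤ v ^ s * F S
    ∑ρ-upper step zero    S = ℕ.≤-refl
    ∑ρ-upper step (suc s) S = begin
      u * u ^ s * ∑ρ (suc s) F S              ≡⟨ xy∙z≈y∙xz u (u ^ s) _ ⟩
      u ^ s * (u * ∑ρ (suc s) F S)            ≡⟨ x∙yz≈y∙xz (u ^ s) u _ ⟩
      u * (u ^ s * ∑ρ (suc s) F S)            ≡⟨ cong (u *_) (*-distribˡ-sum (u ^ s) (λ y → ∑ρ s F (ρ y S))) ⟩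
      u * sum (λ y → u ^ s * ∑ρ s F (ρ y S))  ≤⟨ ℕ.*-monoʳ-≤ u (∑-mono-≤ (λ y → ∑ρ-upper step s (ρ y S))) ⟩
      u * sum (λ y → v ^ s * F (ρ y S))       ≡⟨ cong (u *_) (*-distribˡ-sum (v ^ s) (λ y → F (ρ y S))) ⟨
      u * (v ^ s * sum (λ y → F (ρ y S)))     ≡⟨ x∙yz≈y∙xz u (v ^ s) _ ⟩
      v ^ s * (u * sum (λ y → F (ρ y S)))     ≤⟨ ℕ.*-monoʳ-≤ (v ^ s) (step S) ⟩
      v ^ s * (v * F S)                       ≡⟨ xy∙z≈y∙xz v (v ^ s) (F S) ⟨
      v * v ^ s * F S                         ∎
      where open ℕ.≤-Reasoning

deletion-arith : ∀ P x y r k w s' → 0 < P →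
  P * x + y * (P * k) ≤ P * (y * r) + y * w → 2 * (y * w) ≤ P * x → r ≤ s' + k →
  x ≤ 2 * (y * s')
deletion-arith P x y r k w s' P>0 avg bad del =
  ℕ.+-cancelʳ-≤ (2 * (y * k)) x (2 * (y * s')) (begin
    x + 2 * (y * k)          ≤⟨ ℕ.*-cancelˡ-≤ P {{>-nonZero P>0}} weighted ⟩
    2 * (y * r)              ≤⟨ ℕ.*-monoʳ-≤ 2 (ℕ.*-monoʳ-≤ y del) ⟩
    2 * (y * (s' + k))       ≡⟨ distrib 2 y s' k ⟩
    2 * (y * s') + 2 * (y * k) ∎)
  where
  open ℕ.≤-Reasoning
  distrib : ∀ c y s' k → c * (y * (s' + k)) ≡ c * (y * s') + c * (y * k)
  distrib = solve-∀
  weighted : P * (x + 2 * (y * k)) ≤ P * (2 * (y * r))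
  weighted = ℕ.+-cancelʳ-≤ (P * x) _ _ (begin
    P * (x + 2 * (y * k)) + P * x        ≡⟨ e₁ P x y k ⟩
    2 * (P * x + y * (P * k))           ≤⟨ ℕ.*-monoʳ-≤ 2 avg ⟩
    2 * (P * (y * r) + y * w)           ≡⟨ e₂ P y r w ⟩
    P * (2 * (y * r)) + 2 * (y * w)     ≤⟨ ℕ.+-monoʳ-≤ (P * (2 * (y * r))) bad ⟩
    P * (2 * (y * r)) + P * x           ∎)
    where
    e₁ : ∀ P x y k → P * (x + 2 * (y * k)) + P * x ≡ 2 * (P * x + y * (P * k))
    e₁ = solve-∀
    e₂ : ∀ P y r w → 2 * (P * (y * r) + y * w) ≡ P * (2 * (y * r)) + 2 * (y * w)
    e₂ = solve-∀

module Bipartite {n ℓ} (E : Fin n → Fin ℓ → Bool) where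

  nbhd : Fin ℓ → Subset n
  nbhd y = tabulate λ x → E x y

  -- Written exactly as Defs.N, so that N G T j is commonNbhd T for the adjacency between Z_k and Z_j.
  commonNbhd : Subset n → Subset ℓ
  commonNbhd T = tabulate λ y → allFin λ x → not (lookup T x) ∨ E x y

  ∈commonNbhd⇔ : ∀ {y T} → y ∈ commonNbhd T ⇔ T ⊆ nbhd y
  ∈commonNbhd⇔ {y} {T} = mk⇔
    (λ y∈ {x} x∈T → Equivalence.from (∈tabulate⇔ (λ x → E x y))
      (subst (λ b → not b ∨ E x y ≡ true) ([]=⇒lookup x∈T)
        (Equivalence.to (allFin≡true⇔ _) (Equivalence.to (∈tabulate⇔ _) y∈) x)))
    (λ T⊆ → Equivalence.from (∈tabulate⇔ _) (Equivalence.from (allFin≡true⇔ _) (edge T⊆)))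
    where
    edge : T ⊆ nbhd y → ∀ x → not (lookup T x) ∨ E x y ≡ true
    edge T⊆ x with lookup T x in x∈T
    ... | false = refl
    ... | true  = Equivalence.to (∈tabulate⇔ (λ x → E x y)) (T⊆ (lookup⇒[]= x T x∈T))

  ∈nbhd⇔∈commonNbhd⁅⁆ : ∀ {x y} → x ∈ nbhd y ⇔ y ∈ commonNbhd ⁅ x ⁆
  ∈nbhd⇔∈commonNbhd⁅⁆ = ⇔-trans (⇔-sym ⁅x⁆⊆p⇔x∈p) (⇔-sym ∈commonNbhd⇔)

  ∑∣∩nbhd∣≡∑deg : ∀ S → sum (λ y → ∣ S ∩ nbhd y ∣) ≡ sum (λ x → 𝟙 (x ∈? S) * ∣ commonNbhd ⁅ x ⁆ ∣)
  ∑∣∩nbhd∣≡∑deg S = begin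
    sum (λ y → ∣ S ∩ nbhd y ∣)
      ≡⟨ sum-cong-≗ (λ y → ∣p∣≡∑∈ (S ∩ nbhd y)) ⟩
    sum (λ y → sum (λ x → 𝟙 (x ∈? S ∩ nbhd y)))
      ≡⟨ sum-cong-≗ (λ y → sum-cong-≗ (λ x → trans (𝟙-∈∩ x S (nbhd y))
           (cong (𝟙 (x ∈? S) *_) (𝟙-⇔ (x ∈? nbhd y) (y ∈? commonNbhd ⁅ x ⁆) ∈nbhd⇔∈commonNbhd⁅⁆)))) ⟩
    sum (λ y → sum (λ x → 𝟙 (x ∈? S) * 𝟙 (y ∈? commonNbhd ⁅ x ⁆)))
      ≡⟨ ∑-comm (λ y x → 𝟙 (x ∈? S) * 𝟙 (y ∈? commonNbhd ⁅ x ⁆)) ⟩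
    sum (λ x → sum (λ y → 𝟙 (x ∈? S) * 𝟙 (y ∈? commonNbhd ⁅ x ⁆)))
      ≡⟨ sum-cong-≗ (λ x → trans (sym (*-distribˡ-sum (𝟙 (x ∈? S)) (λ y → 𝟙 (y ∈? commonNbhd ⁅ x ⁆))))
           (cong (𝟙 (x ∈? S) *_) (sym (∣p∣≡∑∈ (commonNbhd ⁅ x ⁆))))) ⟩
    sum (λ x → 𝟙 (x ∈? S) * ∣ commonNbhd ⁅ x ⁆ ∣) ∎
    where open ≡-Reasoning

  module _ (a b : ℕ) (deg : ∀ x → a * ℓ ≤ b * ∣ commonNbhd ⁅ x ⁆ ∣) where

    ∑∣∩nbhd∣-lower : ∀ S → a * ℓ * ∣ S ∣ ≤ b * sum (λ y → ∣ S ∩ nbhd y ∣)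
    ∑∣∩nbhd∣-lower S = begin
      a * ℓ * ∣ S ∣                                      ≡⟨ cong (a * ℓ *_) (∣p∣≡∑∈ S) ⟩
      a * ℓ * sum (λ x → 𝟙 (x ∈? S))                     ≡⟨ *-distribˡ-sum (a * ℓ) (λ x → 𝟙 (x ∈? S)) ⟩
      sum (λ x → a * ℓ * 𝟙 (x ∈? S))                     ≤⟨ ∑-mono-≤ (λ x → ≤-of-member x) ⟩
      sum (λ x → b * (𝟙 (x ∈? S) * ∣ commonNbhd ⁅ x ⁆ ∣)) ≡⟨ *-distribˡ-sum b (λ x → 𝟙 (x ∈? S) * ∣ commonNbhd ⁅ x ⁆ ∣) ⟨
      b * sum (λ x → 𝟙 (x ∈? S) * ∣ commonNbhd ⁅ x ⁆ ∣)   ≡⟨ cong (b *_) (∑∣∩nbhd∣≡∑deg S) ⟨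
      b * sum (λ y → ∣ S ∩ nbhd y ∣)                     ∎
      where
      open ℕ.≤-Reasoning
      ≤-of-member : ∀ x → a * ℓ * 𝟙 (x ∈? S) ≤ b * (𝟙 (x ∈? S) * ∣ commonNbhd ⁅ x ⁆ ∣)
      ≤-of-member x = subst₂ _≤_ (ℕ.*-comm _ (a * ℓ)) (x∙yz≈y∙xz (𝟙 (x ∈? S)) b _)
        (ℕ.*-monoʳ-≤ (𝟙 (x ∈? S)) (deg x))

  ⊆∩nbhd⇔ : ∀ {T S y} → T ⊆ S ∩ nbhd y ⇔ (T ⊆ S × y ∈ commonNbhd T)
  ⊆∩nbhd⇔ {T} {S} {y} = mk⇔
    (λ T⊆ → (λ {x} x∈T → p∩q⊆p S (nbhd y) (T⊆ x∈T)) , Equivalence.from ∈commonNbhd⇔ (λ {x} x∈T → p∩q⊆q S (nbhd y) (T⊆ x∈T)))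
    (λ (T⊆S , y∈) {x} x∈T → x∈p∩q⁺ (T⊆S x∈T , Equivalence.to ∈commonNbhd⇔ y∈ x∈T))

  module BadSets (A B t : ℕ) where

    Bad : Subset n → Set
    Bad T = ∣ T ∣ ≡ t × B * ∣ commonNbhd T ∣ < A * ℓ

    bad? : ∀ T → Dec (Bad T)
    bad? T = ∣ T ∣ ℕ.≟ t ×-dec B * ∣ commonNbhd T ∣ ℕ.<? A * ℓ

    #bad : Subset n → ℕ
    #bad S = ∑ₛ λ T → 𝟙 (T ⊆? S ×-dec bad? T)

    ∑#bad∩nbhd : ∀ S → sum (λ y → #bad (S ∩ nbhd y)) ≡ ∑ₛ (λ T → 𝟙 (T ⊆? S ×-dec bad? T) * ∣ commonNbhd T ∣)
    ∑#bad∩nbhd S = trans (∑-∑ₛ-comm (λ y T → 𝟙 (T ⊆? S ∩ nbhd y ×-dec bad? T))) (∑ₛ-cong count-y)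
      where
      count-y : ∀ T → sum (λ y → 𝟙 (T ⊆? S ∩ nbhd y ×-dec bad? T)) ≡ 𝟙 (T ⊆? S ×-dec bad? T) * ∣ commonNbhd T ∣
      count-y T = begin
        sum (λ y → 𝟙 (T ⊆? S ∩ nbhd y ×-dec bad? T))
          ≡⟨ sum-cong-≗ (λ y → trans (𝟙-⇔ (T ⊆? S ∩ nbhd y ×-dec bad? T) ((T ⊆? S ×-dec bad? T) ×-dec y ∈? commonNbhd T)
                 (mk⇔ (λ (T⊆ , bad) → let T⊆S , y∈ = Equivalence.to ⊆∩nbhd⇔ T⊆ in (T⊆S , bad) , y∈)
                      (λ ((T⊆S , bad) , y∈) → Equivalence.from ⊆∩nbhd⇔ (T⊆S , y∈) , bad)))
               (𝟙-× (T ⊆? S ×-dec bad? T) (y ∈? commonNbhd T))) ⟩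
        sum (λ y → 𝟙 (T ⊆? S ×-dec bad? T) * 𝟙 (y ∈? commonNbhd T))
          ≡⟨ *-distribˡ-sum (𝟙 (T ⊆? S ×-dec bad? T)) (λ y → 𝟙 (y ∈? commonNbhd T)) ⟨
        𝟙 (T ⊆? S ×-dec bad? T) * sum (λ y → 𝟙 (y ∈? commonNbhd T))
          ≡⟨ cong (𝟙 (T ⊆? S ×-dec bad? T) *_) (∣p∣≡∑∈ (commonNbhd T)) ⟨
        𝟙 (T ⊆? S ×-dec bad? T) * ∣ commonNbhd T ∣ ∎
        where open ≡-Reasoning

    ∑#bad∩nbhd-upper : ∀ S → B * sum (λ y → #bad (S ∩ nbhd y)) ≤ A * ℓ * #bad S
    ∑#bad∩nbhd-upper S = begin
      B * sum (λ y → #bad (S ∩ nbhd y))                           ≡⟨ cong (B *_) (∑#bad∩nbhd S) ⟩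
      B * ∑ₛ (λ T → 𝟙 (T ⊆? S ×-dec bad? T) * ∣ commonNbhd T ∣)  ≡⟨ ∑ₛ-*ˡ B (λ T → 𝟙 (T ⊆? S ×-dec bad? T) * ∣ commonNbhd T ∣) ⟨
      ∑ₛ (λ T → B * (𝟙 (T ⊆? S ×-dec bad? T) * ∣ commonNbhd T ∣)) ≤⟨ ∑ₛ-mono-≤ term ⟩
      ∑ₛ (λ T → A * ℓ * 𝟙 (T ⊆? S ×-dec bad? T))                 ≡⟨ ∑ₛ-*ˡ (A * ℓ) (λ T → 𝟙 (T ⊆? S ×-dec bad? T)) ⟩
      A * ℓ * #bad S                                             ∎
      where
      open ℕ.≤-Reasoning
      term : ∀ T → B * (𝟙 (T ⊆? S ×-dec bad? T) * ∣ commonNbhd T ∣) ≤ A * ℓ * 𝟙 (T ⊆? S ×-dec bad? T)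
      term T = subst₂ _≤_ (x∙yz≈y∙xz (𝟙 (T ⊆? S ×-dec bad? T)) B _) (ℕ.*-comm _ (A * ℓ))
        (𝟙*-mono-≤ (T ⊆? S ×-dec bad? T) (λ (_ , _ , small) → ℕ.<⇒≤ small))

    #bad≤∣S∣*n^t-1 : ∀ {t'} → t ≡ suc t' → ∀ S → #bad S ≤ ∣ S ∣ * n ^ t'
    #bad≤∣S∣*n^t-1 {t'} refl S = begin
      #bad S                ≤⟨ ∑ₛ-mono-≤ (λ T → 𝟙-mono (T ⊆? S ×-dec bad? T) (T ⊆? S ×-dec ∣ T ∣ ℕ.≟ t) (λ (T⊆S , ∣T∣≡t , _) → T⊆S , ∣T∣≡t)) ⟩
      #subsetsOfSize S t    ≤⟨ #subsetsOfSize≤∣S∣^t S t ⟩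
      ∣ S ∣ * ∣ S ∣ ^ t'    ≤⟨ ℕ.*-monoʳ-≤ ∣ S ∣ (ℕ.^-monoˡ-≤ t' (∣p∣≤n S)) ⟩
      ∣ S ∣ * n ^ t'        ∎
      where open ℕ.≤-Reasoning

    #bad-shrink : 0 < t → ∀ S → 0 < #bad S → ∃[ x ] x ∈ S × #bad (S - x) < #bad S
    #bad-shrink t>0 S #bad>0 =
      let T , 𝟙>0        = ∑ₛ>0⇒∃ _ #bad>0
          T⊆S , ∣T∣≡t , _ = 𝟙>0⇒ (T ⊆? S ×-dec bad? T) 𝟙>0
          x , x∈T        = ∣p∣>0⇒Nonempty T (subst (0 <_) (sym ∣T∣≡t) t>0)
      in x , T⊆S x∈T , ∑ₛ-mono-<
        (λ T' → 𝟙-mono (T' ⊆? S - x ×-dec bad? T') (T' ⊆? S ×-dec bad? T') (λ (T'⊆ , bad) → ⊆-trans T'⊆ (p─q⊆p S ⁅ x ⁆) , bad))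
        T (subst₂ _<_ (sym (𝟙-no (T ⊆? S - x ×-dec bad? T) (λ (T⊆S-x , _) → x∉p-x x S (T⊆S-x x∈T))))
                      (sym (𝟙-yes (T ⊆? S ×-dec bad? T) (𝟙>0⇒ (T ⊆? S ×-dec bad? T) 𝟙>0))) (s≤s z≤n))

    #bad≡0⇒good : ∀ {S T} → #bad S ≡ 0 → T ⊆ S → ∣ T ∣ ≡ t → A * ℓ ≤ B * ∣ commonNbhd T ∣
    #bad≡0⇒good {S} {T} #bad≡0 T⊆S ∣T∣≡t = ℕ.≮⇒≥ λ small →
      contradiction (subst (1 ≤_) #bad≡0
        (subst (_≤ #bad S) (𝟙-yes (T ⊆? S ×-dec bad? T) (T⊆S , ∣T∣≡t , small)) (term≤∑ₛ _ T)))
        λ ()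

    module _ (a b : ℕ) (deg : ∀ x → a * ℓ ≤ b * ∣ commonNbhd ⁅ x ⁆ ∣) (ℓ>0 : 0 < ℓ) where
      open Refinements (λ y S → S ∩ nbhd y)

      -- γ ^ s |S| + #bad R ≤ |R| + (A / B) ^ s #bad S for some R, multiplied by (b B) ^ s.
      averaging : ∀ s S → ∃[ R ] R ⊆ S ×
        B ^ s * (a ^ s * ∣ S ∣) + b ^ s * (B ^ s * #bad R) ≤ B ^ s * (b ^ s * ∣ R ∣) + b ^ s * (A ^ s * #bad S)
      averaging s S = ∑ρ≤∑ρ⇒∃≤ (λ y R → p∩q⊆p R (nbhd y)) ℓ>0 s f g S (begin
        ∑ρ s f S
          ≡⟨ ∑ρ-+ s _ _ S ⟩
        ∑ρ s (λ _ → B ^ s * (a ^ s * ∣ S ∣)) S + ∑ρ s (λ R → b ^ s * (B ^ s * #bad R)) S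
          ≡⟨ cong₂ _+_ (∑ρ-const s _ S) (trans (∑ρ-*ˡ s (b ^ s) _ S) (cong (b ^ s *_) (∑ρ-*ˡ s (B ^ s) #bad S))) ⟩
        ℓ ^ s * (B ^ s * (a ^ s * ∣ S ∣)) + b ^ s * (B ^ s * ∑ρ s #bad S)
          ≡⟨ cong (_+ b ^ s * (B ^ s * ∑ρ s #bad S)) (rearrange (ℓ ^ s) (B ^ s) (a ^ s) ∣ S ∣) ⟩
        B ^ s * (a ^ s * ℓ ^ s * ∣ S ∣) + b ^ s * (B ^ s * ∑ρ s #bad S)
          ≡⟨ cong (λ z → B ^ s * (z * ∣ S ∣) + b ^ s * (B ^ s * ∑ρ s #bad S)) (^-distribʳ-* a ℓ s) ⟨
        B ^ s * ((a * ℓ) ^ s * ∣ S ∣) + b ^ s * (B ^ s * ∑ρ s #bad S)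
          ≤⟨ ℕ.+-mono-≤ (ℕ.*-monoʳ-≤ (B ^ s) (∑ρ-lower ∣_∣ (a * ℓ) b (∑∣∩nbhd∣-lower a b deg) s S))
                        (ℕ.*-monoʳ-≤ (b ^ s) (∑ρ-upper #bad B (A * ℓ) ∑#bad∩nbhd-upper s S)) ⟩
        B ^ s * (b ^ s * ∑ρ s ∣_∣ S) + b ^ s * ((A * ℓ) ^ s * #bad S)
          ≡⟨ cong (λ z → B ^ s * (b ^ s * ∑ρ s ∣_∣ S) + b ^ s * (z * #bad S)) (^-distribʳ-* A ℓ s) ⟩
        B ^ s * (b ^ s * ∑ρ s ∣_∣ S) + b ^ s * (A ^ s * ℓ ^ s * #bad S)
          ≡⟨ cong (B ^ s * (b ^ s * ∑ρ s ∣_∣ S) +_) (rearrange (ℓ ^ s) (b ^ s) (A ^ s) (#bad S)) ⟨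
        B ^ s * (b ^ s * ∑ρ s ∣_∣ S) + ℓ ^ s * (b ^ s * (A ^ s * #bad S))
          ≡⟨ cong₂ _+_ (trans (∑ρ-*ˡ s (B ^ s) (λ R → b ^ s * ∣ R ∣) S) (cong (B ^ s *_) (∑ρ-*ˡ s (b ^ s) ∣_∣ S))) (∑ρ-const s _ S) ⟨
        ∑ρ s (λ R → B ^ s * (b ^ s * ∣ R ∣)) S + ∑ρ s (λ _ → b ^ s * (A ^ s * #bad S)) S
          ≡⟨ ∑ρ-+ s _ _ S ⟨
        ∑ρ s g S ∎)
        where
        open ℕ.≤-Reasoning
        f g : Subset n → ℕ
        f R = B ^ s * (a ^ s * ∣ S ∣) + b ^ s * (B ^ s * #bad R)
        g R = B ^ s * (b ^ s * ∣ R ∣) + b ^ s * (A ^ s * #bad S)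
        rearrange : ∀ w x y z → w * (x * (y * z)) ≡ x * (y * w * z)
        rearrange = solve-∀

      dependentRandomChoice : ∀ {t'} → t ≡ suc t' → 0 < B → ∀ s → 2 * ((A * b) ^ s * n ^ t') ≤ (a * B) ^ s →
        ∀ S → ∃[ S' ] S' ⊆ S × a ^ s * ∣ S ∣ ≤ 2 * (b ^ s * ∣ S' ∣) ×
          (∀ {T} → T ⊆ S' → ∣ T ∣ ≡ t → A * ℓ ≤ B * ∣ commonNbhd T ∣)
      dependentRandomChoice {t'} t≡1+t' B>0 s cond S =
        let R , R⊆S , avg = averaging s S
            S' , S'⊆R , ∣R∣≤ , #badS'≡0 = deleteUntilZero #bad (#bad-shrink (subst (0 <_) (sym t≡1+t') (s≤s z≤n))) R
        in S' , ⊆-trans S'⊆R R⊆S ,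
           deletion-arith (B ^ s) (a ^ s * ∣ S ∣) (b ^ s) (∣ R ∣) (#bad R) (A ^ s * #bad S) (∣ S' ∣)
             (ℕ.m^n>0 B {{>-nonZero B>0}} s) avg fewBad ∣R∣≤ ,
           #bad≡0⇒good #badS'≡0
        where
        open ℕ.≤-Reasoning
        fewBad : 2 * (b ^ s * (A ^ s * #bad S)) ≤ B ^ s * (a ^ s * ∣ S ∣)
        fewBad = begin
          2 * (b ^ s * (A ^ s * #bad S))
            ≤⟨ ℕ.*-monoʳ-≤ 2 (ℕ.*-monoʳ-≤ (b ^ s) (ℕ.*-monoʳ-≤ (A ^ s) (#bad≤∣S∣*n^t-1 t≡1+t' S))) ⟩
          2 * (b ^ s * (A ^ s * (∣ S ∣ * n ^ t')))
            ≡⟨ e₁ (A ^ s) (b ^ s) (n ^ t') ∣ S ∣ ⟩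
          2 * (A ^ s * b ^ s * n ^ t') * ∣ S ∣
            ≡⟨ cong (λ z → 2 * (z * n ^ t') * ∣ S ∣) (^-distribʳ-* A b s) ⟨
          2 * ((A * b) ^ s * n ^ t') * ∣ S ∣
            ≤⟨ ℕ.*-monoˡ-≤ ∣ S ∣ cond ⟩
          (a * B) ^ s * ∣ S ∣
            ≡⟨ cong (_* ∣ S ∣) (^-distribʳ-* a B s) ⟩
          a ^ s * B ^ s * ∣ S ∣
            ≡⟨ e₂ (a ^ s) (B ^ s) ∣ S ∣ ⟩
          B ^ s * (a ^ s * ∣ S ∣) ∎
          where
          e₁ : ∀ x y z w → 2 * (y * (x * (w * z))) ≡ 2 * (x * y * z) * w
          e₁ = solve-∀
          e₂ : ∀ x y w → x * y * w ≡ y * (x * w)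
          e₂ = solve-∀

module _ {n ℓ} (A B a b t' s : ℕ) (B>0 : 0 < B) (ℓ>0 : 0 < ℓ)
         (cond : 2 * ((A * b) ^ s * n ^ t') ≤ (a * B) ^ s) where
  open Bipartite using (commonNbhd)

  dependentRandomChoice-parts : ∀ {k} (E : Fin k → Fin n → Fin ℓ → Bool) →
    (∀ i x → a * ℓ ≤ b * ∣ commonNbhd (E i) ⁅ x ⁆ ∣) → ∀ S →
    ∃[ S' ] S' ⊆ S × (a ^ s) ^ k * ∣ S ∣ ≤ (2 * b ^ s) ^ k * ∣ S' ∣ ×
      (∀ i {T} → T ⊆ S' → ∣ T ∣ ≡ suc t' → A * ℓ ≤ B * ∣ commonNbhd (E i) T ∣)
  dependentRandomChoice-parts {zero}  E deg S = S , (λ x∈S → x∈S) , ℕ.≤-refl , λ ()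
  dependentRandomChoice-parts {suc k} E deg S =
    let S₁ , S₁⊆S , size₁ , good₁ = Bipartite.BadSets.dependentRandomChoice (E zero) A B (suc t') a b (deg zero) ℓ>0 refl B>0 s cond S
        S₂ , S₂⊆S₁ , size₂ , good₂ = dependentRandomChoice-parts (E ∘ suc) (deg ∘ suc) S₁
    in S₂ , ⊆-trans S₂⊆S₁ S₁⊆S , (begin
      a ^ s * (a ^ s) ^ k * ∣ S ∣       ≡⟨ xy∙z≈y∙xz (a ^ s) _ ∣ S ∣ ⟩
      (a ^ s) ^ k * (a ^ s * ∣ S ∣)     ≤⟨ ℕ.*-monoʳ-≤ ((a ^ s) ^ k) size₁ ⟩
      (a ^ s) ^ k * (2 * (b ^ s * ∣ S₁ ∣)) ≡⟨ e (b ^ s) ((a ^ s) ^ k) ∣ S₁ ∣ ⟩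
      2 * b ^ s * ((a ^ s) ^ k * ∣ S₁ ∣) ≤⟨ ℕ.*-monoʳ-≤ (2 * b ^ s) size₂ ⟩
      2 * b ^ s * ((2 * b ^ s) ^ k * ∣ S₂ ∣) ≡⟨ ℕ.*-assoc (2 * b ^ s) _ ∣ S₂ ∣ ⟨
      2 * b ^ s * (2 * b ^ s) ^ k * ∣ S₂ ∣ ∎) ,
       λ { zero T⊆S₂ → good₁ (⊆-trans T⊆S₂ S₂⊆S₁) ; (suc i) → good₂ i }
    where
    open ℕ.≤-Reasoning
    e : ∀ y x z → x * (2 * (y * z)) ≡ 2 * y * (x * z)
    e = solve-∀

-- Choice of the parameters

-- x ≤[ e ] y  says  x ≤ (b / a) ^ e · y.  It is a record so that x, e and y can be inferred.
module Ratio (a b : ℕ) where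

  infix 4 _≤[_]_
  record _≤[_]_ (x e y : ℕ) : Set where
    constructor mk≤[]
    field ≤[]⇒≤ : a ^ e * x ≤ b ^ e * y
  open _≤[_]_ public

  ≤[]-* : ∀ {e f x y x' y'} → x ≤[ e ] y → x' ≤[ f ] y' → x * x' ≤[ e + f ] y * y'
  ≤[]-* {e} {f} {x} {y} {x'} {y'} (mk≤[] x≤y) (mk≤[] x'≤y') = mk≤[] (begin
    a ^ (e + f) * (x * x')         ≡⟨ cong (_* (x * x')) (ℕ.^-distribˡ-+-* a e f) ⟩
    a ^ e * a ^ f * (x * x')       ≡⟨ *-interchange (a ^ e) (a ^ f) x x' ⟩
    a ^ e * x * (a ^ f * x')       ≤⟨ ℕ.*-mono-≤ x≤y x'≤y' ⟩
    b ^ e * y * (b ^ f * y')       ≡⟨ *-interchange (b ^ e) (b ^ f) y y' ⟨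
    b ^ e * b ^ f * (y * y')       ≡⟨ cong (_* (y * y')) (ℕ.^-distribˡ-+-* b e f) ⟨
    b ^ (e + f) * (y * y')         ∎)
    where open ℕ.≤-Reasoning

  ^-power : ∀ c e z p → (c ^ e * z) ^ p ≡ c ^ (e * p) * z ^ p
  ^-power c e z p = trans (^-distribʳ-* (c ^ e) z p) (cong (_* z ^ p) (ℕ.^-*-assoc c e p))

  ≤[]-^ : ∀ {e x y} p → x ≤[ e ] y → x ^ p ≤[ e * p ] y ^ p
  ≤[]-^ {e} {x} {y} p (mk≤[] x≤y) = mk≤[] (subst₂ _≤_ (^-power a e x p) (^-power b e y p) (ℕ.^-monoˡ-≤ p x≤y))

  ≤[]-root : ∀ {e x y} p → 0 < p → x ^ p ≤[ e * p ] y ^ p → x ≤[ e ] y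
  ≤[]-root {e} {x} {y} p p>0 (mk≤[] x≤y) with (a ^ e * x) ℕ.≤? (b ^ e * y)
  ... | yes x≤y' = mk≤[] x≤y'
  ... | no  x≰y' = contradiction (subst₂ _≤_ (sym (^-power a e x p)) (sym (^-power b e y p)) x≤y)
                     (ℕ.<⇒≱ (ℕ.^-monoˡ-< p {{>-nonZero p>0}} (ℕ.≰⇒> x≰y')))

  ≤[]-cancelʳ : ∀ {e x y} c → 0 < c → x * c ≤[ e ] y * c → x ≤[ e ] y
  ≤[]-cancelʳ {e} {x} {y} c c>0 (mk≤[] xc≤yc) = mk≤[] (ℕ.*-cancelʳ-≤ (a ^ e * x) (b ^ e * y) c {{>-nonZero c>0}}
    (subst₂ _≤_ (sym (ℕ.*-assoc (a ^ e) x c)) (sym (ℕ.*-assoc (b ^ e) y c)) xc≤yc))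

  module _ (a≤b : a ≤ b) where

    ≤[]-weaken : ∀ {e f x y} → e ≤ f → x ≤[ e ] y → x ≤[ f ] y
    ≤[]-weaken {e} {f} {x} {y} e≤f x≤y with ℕ.m≤n⇒∃[o]m+o≡n e≤f
    ... | d , refl = subst₂ (λ u v → u ≤[ e + d ] v) (ℕ.*-identityʳ x) (ℕ.*-identityʳ y)
      (≤[]-* x≤y (mk≤[] (ℕ.*-monoˡ-≤ 1 (ℕ.^-monoˡ-≤ d a≤b))))

module _ {a b} (a>0 : 0 < a) (a<b : a < b) where
  open Ratio a b

  2≤[a]1 : 2 ≤[ a ] 1
  2≤[a]1 = mk≤[] (ℕ.≤-trans (ℕ.*-cancelˡ-≤ a {{>-nonZero a>0}} (subst (_≤ a * suc a ^ a) (e a (a ^ a)) (^-bernoulli a a)))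
                     (ℕ.≤-trans (ℕ.^-monoˡ-≤ a a<b) (ℕ.≤-reflexive (sym (ℕ.*-identityʳ (b ^ a))))))
    where
    e : ∀ a x → x * (a + a) ≡ a * (x * 2)
    e = solve-∀

-- The number m of parts to clean up is m' + 1, the size of the t-sets is t' + 1, and c = p / q < 1.
module Parameters (m' t' : ℕ) {a b : ℕ} (a>0 : 0 < a) (a<b : a < b) {p q : ℕ} (p>0 : 0 < p) (p<q : p < q) (n : ℕ) where
  open Ratio a b

  m M C : ℕ
  m = suc m'
  M = m * q
  C = m * (1 + b * suc a)

  instance
    a≢0 : NonZero a
    a≢0 = >-nonZero a>0
    p≢0 : NonZero p
    p≢0 = >-nonZero p>0
    M≢0 : NonZero M
    M≢0 = ℕ.m*n≢0 m q {{_}} {{>-nonZero (ℕ.<-trans p>0 p<q)}}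

  -- s rounds per part are affordable iff (2 / γ ^ s) ^ m ≤ n ^ c, i.e. iff they keep
  -- (γ ^ s / 2) ^ m · n ≥ n ^ (1 - c) vertices.
  Affordable : ℕ → Set
  Affordable s = 2 ^ M * b ^ (s * M) ≤ a ^ (s * M) * n ^ p

  affordable-start : 2 ^ (C * q) ≤ n ^ p → Affordable (suc a)
  affordable-start 2^Cq≤n^p = begin
    2 ^ M * b ^ (suc a * M)                            ≤⟨ ℕ.*-monoʳ-≤ (2 ^ M) (ℕ.^-monoˡ-≤ (suc a * M) b≤2^b*a) ⟩
    2 ^ M * (2 ^ b * a) ^ (suc a * M)                  ≡⟨ cong (2 ^ M *_) (^-distribʳ-* (2 ^ b) a (suc a * M)) ⟩
    2 ^ M * ((2 ^ b) ^ (suc a * M) * a ^ (suc a * M))  ≡⟨ cong (λ z → 2 ^ M * (z * a ^ (suc a * M))) (ℕ.^-*-assoc 2 b (suc a * M)) ⟩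
    2 ^ M * (2 ^ (b * (suc a * M)) * a ^ (suc a * M))  ≡⟨ ℕ.*-assoc (2 ^ M) _ _ ⟨
    2 ^ M * 2 ^ (b * (suc a * M)) * a ^ (suc a * M)    ≡⟨ cong (_* a ^ (suc a * M)) (sym (trans (cong (2 ^_) (exponent m q b a)) (ℕ.^-distribˡ-+-* 2 M _))) ⟩
    2 ^ (C * q) * a ^ (suc a * M)                      ≤⟨ ℕ.*-monoˡ-≤ (a ^ (suc a * M)) 2^Cq≤n^p ⟩
    n ^ p * a ^ (suc a * M)                            ≡⟨ ℕ.*-comm (n ^ p) _ ⟩
    a ^ (suc a * M) * n ^ p                            ∎
    where
    open ℕ.≤-Reasoning
    b≤2^b*a : b ≤ 2 ^ b * a
    b≤2^b*a = ℕ.≤-trans (ℕ.<⇒≤ (k<2^k b)) (ℕ.m≤m*n (2 ^ b) a)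
    exponent : ∀ m q b a → m * (1 + b * suc a) * q ≡ m * q + b * (suc a * (m * q))
    exponent = solve-∀

  unaffordable : ¬ Affordable (suc a + a * n ^ p)
  unaffordable affordable = ℕ.<⇒≱ (ℕ.<-≤-trans (k<2^k (n ^ p)) (ℕ.^-monoʳ-≤ 2 (ℕ.m≤m*n (n ^ p) M)))
    (ℕ.*-cancelˡ-≤ (a ^ (s * M)) {{ℕ.m^n≢0 a (s * M)}} (begin
      a ^ (s * M) * 2 ^ (n ^ p * M)  ≤⟨ ≤[]⇒≤ (≤[]-weaken (ℕ.<⇒≤ a<b) exponent (≤[]-^ (n ^ p * M) (2≤[a]1 a>0 a<b))) ⟩
      b ^ (s * M) * 1 ^ (n ^ p * M)  ≡⟨ cong (b ^ (s * M) *_) (ℕ.^-zeroˡ (n ^ p * M)) ⟩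
      b ^ (s * M) * 1                ≤⟨ ℕ.*-monoʳ-≤ (b ^ (s * M)) (ℕ.m^n>0 2 M) ⟩
      b ^ (s * M) * 2 ^ M            ≡⟨ ℕ.*-comm (b ^ (s * M)) _ ⟩
      2 ^ M * b ^ (s * M)            ≤⟨ affordable ⟩
      a ^ (s * M) * n ^ p            ∎))
    where
    open ℕ.≤-Reasoning
    s = suc a + a * n ^ p
    exponent : a * (n ^ p * M) ≤ s * M
    exponent = ℕ.≤-trans (ℕ.≤-reflexive (sym (ℕ.*-assoc a (n ^ p) M))) (ℕ.*-monoˡ-≤ M (ℕ.m≤n+m (a * n ^ p) (suc a)))

  lastAffordable : 2 ^ (C * q) ≤ n ^ p → ∃[ s ] suc a ≤ s × Affordable s × ¬ Affordable (suc s)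
  lastAffordable 2^Cq≤n^p = lastTrue (λ s → _ ℕ.≤? _) (a * n ^ p) (affordable-start 2^Cq≤n^p) unaffordable

  -- The threshold exponent: γ ^ r ≥ γ ^ (K / c), and K₂ = K - 2.
  K K₂ r : ℕ
  K  = 2 * m * (suc t' + 1)
  K₂ = 2 * m * t' + 4 * m' + 2
  r  = K * q / p

  r*p≤K*q : r * p ≤ K * q
  r*p≤K*q = m/n*n≤m (K * q) p

  K*q<r*p+p : K * q < r * p + p
  K*q<r*p+p = begin-strict
    K * q                  ≡⟨ m≡m%n+[m/n]*n (K * q) p ⟩
    (K * q) % p + r * p    <⟨ ℕ.+-monoˡ-< (r * p) (m%n<n (K * q) p) ⟩
    p + r * p              ≡⟨ ℕ.+-comm p (r * p) ⟩
    r * p + p              ∎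
    where open ℕ.≤-Reasoning

  r≡1+L : ∃[ L ] r ≡ suc L × K₂ * q ≤ L * p
  r≡1+L with r | K*q<r*p+p
  ... | zero  | K*q<p    = contradiction (ℕ.<-≤-trans K*q<p (ℕ.<⇒≤ p<q)) (ℕ.≤⇒≯ (ℕ.m≤n*m q K))
  ... | suc L | K*q<r*p+p = L , refl , ℕ.<⇒≤ (ℕ.+-cancelʳ-< (2 * q) (K₂ * q) (L * p) (begin-strict
    K₂ * q + 2 * q         ≡⟨ e₁ m' t' q ⟩
    K * q                  <⟨ K*q<r*p+p ⟩
    p + L * p + p          ≡⟨ e₂ L p ⟩
    L * p + 2 * p          ≤⟨ ℕ.+-monoʳ-≤ (L * p) (ℕ.*-monoʳ-≤ 2 (ℕ.<⇒≤ p<q)) ⟩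
    L * p + 2 * q          ∎))
    where
    open ℕ.≤-Reasoning
    e₁ : ∀ m' t' q → (2 * suc m' * t' + 4 * m' + 2) * q + 2 * q ≡ 2 * suc m' * (suc t' + 1) * q
    e₁ = solve-∀
    e₂ : ∀ L p → p + L * p + p ≡ L * p + 2 * p
    e₂ = solve-∀

  exponents : ∀ {L s} → K₂ * q ≤ L * p → suc a ≤ s → suc s * M * t' + a * (p + M * t') ≤ L * s * p
  exponents {L} K₂q≤Lp 1+a≤s with ℕ.m≤n⇒∃[o]m+o≡n 1+a≤s
  ... | u , refl = begin
    suc s * M * t' + a * (p + M * t')  ≤⟨ ℕ.+-monoʳ-≤ (suc s * M * t') (ℕ.*-monoʳ-≤ a (ℕ.+-monoˡ-≤ (M * t') (ℕ.<⇒≤ p<q))) ⟩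
    suc s * M * t' + a * (q + M * t')  ≤⟨ ℕ.m≤m+n _ _ ⟩
    suc s * M * t' + a * (q + M * t') + q * (m * t' * u + 4 * m' * (a + 1 + u) + a + 2 + 2 * u)
                                       ≡⟨ e₁ m' t' q a u ⟩
    K₂ * q * s                         ≤⟨ ℕ.*-monoˡ-≤ s K₂q≤Lp ⟩
    L * p * s                          ≡⟨ e₂ L p s ⟩
    L * s * p                          ∎
    where
    open ℕ.≤-Reasoning
    s = suc a + u
    e₁ : ∀ m' t' q a u → suc (suc a + u) * (suc m' * q) * t' + a * (q + suc m' * q * t')
           + q * (suc m' * t' * u + 4 * m' * (a + 1 + u) + a + 2 + 2 * u)
         ≡ (2 * suc m' * t' + 4 * m' + 2) * q * (suc a + u)
    e₁ = solve-∀
    e₂ : ∀ L p s → L * p * s ≡ L * s * p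
    e₂ = solve-∀

  -- Maximality of s bounds n ^ p by 2 ^ M (b / a) ^ ((s + 1) M); the remaining factor 2 ^ (p + M t')
  -- costs a (p + M t') further powers of b / a, and s > a makes everything fit into L s p.
  gap : ∀ {L s} → K₂ * q ≤ L * p → suc a ≤ s → ¬ Affordable (suc s) → 2 * n ^ t' ≤[ L * s ] 1
  gap {L} {s} K₂q≤Lp 1+a≤s unaffordable =
    ≤[]-root p p>0 (subst (λ y → (2 * n ^ t') ^ p ≤[ L * s * p ] y) (sym (ℕ.^-zeroˡ p))
      (≤[]-weaken (ℕ.<⇒≤ a<b) (exponents {L} K₂q≤Lp 1+a≤s)
        (≤[]-cancelʳ (2 ^ (M * t')) (ℕ.m^n>0 2 (M * t'))
          (subst₂ (λ x y → x ≤[ suc s * M * t' + a * (p + M * t') ] y) lhs rhs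
            (≤[]-* (≤[]-^ t' n^p≤[]2^M) (≤[]-^ (p + M * t') (2≤[a]1 a>0 a<b)))))))
    where
    n^p≤[]2^M : n ^ p ≤[ suc s * M ] 2 ^ M
    n^p≤[]2^M = mk≤[] (ℕ.≤-trans (ℕ.<⇒≤ (ℕ.≰⇒> unaffordable)) (ℕ.≤-reflexive (ℕ.*-comm (2 ^ M) _)))
    lhs : (n ^ p) ^ t' * 2 ^ (p + M * t') ≡ (2 * n ^ t') ^ p * 2 ^ (M * t')
    lhs = begin
      (n ^ p) ^ t' * 2 ^ (p + M * t')        ≡⟨ cong₂ _*_ (trans (ℕ.^-*-assoc n p t') (trans (cong (n ^_) (ℕ.*-comm p t')) (sym (ℕ.^-*-assoc n t' p)))) (ℕ.^-distribˡ-+-* 2 p (M * t')) ⟩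
      (n ^ t') ^ p * (2 ^ p * 2 ^ (M * t'))  ≡⟨ x∙yz≈yx∙z ((n ^ t') ^ p) (2 ^ p) (2 ^ (M * t')) ⟩
      2 ^ p * (n ^ t') ^ p * 2 ^ (M * t')    ≡⟨ cong (_* 2 ^ (M * t')) (^-distribʳ-* 2 (n ^ t') p) ⟨
      (2 * n ^ t') ^ p * 2 ^ (M * t')        ∎
      where open ≡-Reasoning
    rhs : (2 ^ M) ^ t' * 1 ^ (p + M * t') ≡ 1 * 2 ^ (M * t')
    rhs = trans (cong₂ _*_ (ℕ.^-*-assoc 2 M t') (ℕ.^-zeroˡ (p + M * t'))) (ℕ.*-comm (2 ^ (M * t')) 1)

  roundsCondition : ∀ {L s} → 2 * n ^ t' ≤[ L * s ] 1 → 2 * ((a ^ suc L * b) ^ s * n ^ t') ≤ (a * b ^ suc L) ^ s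
  roundsCondition {L} {s} (mk≤[] 2n^t'≤[]1) = begin
    2 * ((a * a ^ L * b) ^ s * n ^ t')
      ≡⟨ cong (λ z → 2 * (z * n ^ t')) (trans (^-distribʳ-* (a * a ^ L) b s) (cong (_* b ^ s) (trans (^-distribʳ-* a (a ^ L) s) (cong (a ^ s *_) (ℕ.^-*-assoc a L s))))) ⟩
    2 * (a ^ s * a ^ (L * s) * b ^ s * n ^ t')       ≡⟨ e₁ (a ^ s) (a ^ (L * s)) (b ^ s) (n ^ t') ⟩
    a ^ s * b ^ s * (a ^ (L * s) * (2 * n ^ t'))     ≤⟨ ℕ.*-monoʳ-≤ (a ^ s * b ^ s) 2n^t'≤[]1 ⟩
    a ^ s * b ^ s * (b ^ (L * s) * 1)                ≡⟨ e₂ (a ^ s) (b ^ s) (b ^ (L * s)) ⟩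
    a ^ s * (b ^ s * b ^ (L * s))
      ≡⟨ trans (^-distribʳ-* a (b * b ^ L) s) (cong (a ^ s *_) (trans (^-distribʳ-* b (b ^ L) s) (cong (b ^ s *_) (ℕ.^-*-assoc b L s)))) ⟨
    (a * (b * b ^ L)) ^ s                            ∎
    where
    open ℕ.≤-Reasoning
    e₁ : ∀ x y z w → 2 * (x * y * z * w) ≡ x * z * (y * (2 * w))
    e₁ = solve-∀
    e₂ : ∀ x z w → x * z * (w * 1) ≡ x * (z * w)
    e₂ = solve-∀

  rounds : 2 ^ (C * q) ≤ n ^ p →
    ∃[ s ] Affordable s × 2 * ((a ^ r * b) ^ s * n ^ t') ≤ (a * b ^ r) ^ s
  rounds 2^Cq≤n^p with r≡1+L | lastAffordable 2^Cq≤n^p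
  ... | L , r≡1+L , K₂q≤Lp | s , 1+a≤s , affordable , unaffordable =
    s , affordable , subst (λ r' → 2 * ((a ^ r' * b) ^ s * n ^ t') ≤ (a * b ^ r') ^ s) (sym r≡1+L)
                       (roundsCondition {L} {s} (gap {L} K₂q≤Lp 1+a≤s unaffordable))

  affordable⇒size : ∀ {s S} → Affordable s → (a ^ s) ^ m * n ≤ (2 * b ^ s) ^ m * S → n ^ q ≤ (2 * S) ^ q * n ^ p
  affordable⇒size {s} {S} affordable shrunk = begin
    n ^ q                   ≤⟨ ℕ.*-cancelˡ-≤ (a ^ (s * M)) {{ℕ.m^n≢0 a (s * M)}} (begin
      a ^ (s * M) * n ^ q             ≡⟨ trans (cong (_* n ^ q) (trans (sym (ℕ.^-*-assoc a s M)) (sym (ℕ.^-*-assoc (a ^ s) m q)))) (sym (^-distribʳ-* ((a ^ s) ^ m) n q)) ⟩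
      ((a ^ s) ^ m * n) ^ q           ≤⟨ ℕ.^-monoˡ-≤ q shrunk ⟩
      ((2 * b ^ s) ^ m * S) ^ q       ≡⟨ trans (^-distribʳ-* ((2 * b ^ s) ^ m) S q) (cong (_* S ^ q) (trans (ℕ.^-*-assoc (2 * b ^ s) m q) (trans (^-distribʳ-* 2 (b ^ s) M) (cong (2 ^ M *_) (ℕ.^-*-assoc b s M))))) ⟩
      2 ^ M * b ^ (s * M) * S ^ q     ≤⟨ ℕ.*-monoˡ-≤ (S ^ q) affordable ⟩
      a ^ (s * M) * n ^ p * S ^ q     ≡⟨ ℕ.*-assoc (a ^ (s * M)) (n ^ p) (S ^ q) ⟩
      a ^ (s * M) * (n ^ p * S ^ q)   ∎) ⟩
    n ^ p * S ^ q           ≤⟨ ℕ.*-monoʳ-≤ (n ^ p) (ℕ.^-monoˡ-≤ q (ℕ.m≤m+n S (S + 0))) ⟩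
    n ^ p * (2 * S) ^ q     ≡⟨ ℕ.*-comm (n ^ p) _ ⟩
    (2 * S) ^ q * n ^ p     ∎
    where open ℕ.≤-Reasoning

  threshold : ∀ {x y} → a ^ r * x ≤ b ^ r * y → a ^ (K * q) * x ^ p ≤ b ^ (K * q) * y ^ p
  threshold x≤y = ≤[]⇒≤ (≤[]-weaken (ℕ.<⇒≤ a<b) r*p≤K*q (≤[]-^ p (mk≤[] {e = r} x≤y)))

-- Rational values

-- Integer literals are opened only here: globally +_ would clash with sections (n +_) on ℕ.
module _ where

  open import Data.Integer using (+_; -[1+_]; +≤+; +<+) renaming (_≤_ to _≤ℤ_)

  -- x ≃ i / j : x has the value i / j, with j positive.
  infix 4 _≃_/_
  _≃_/_ : ℚ → ℕ → ℕ → Set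
  x ≃ i / j = ∃[ d ] j ≡ suc d × toℚᵘ x ≃ᵘ mkℚᵘ (+ i) d

  ℕ→ℚ-≃ : ∀ n → ℕ→ℚ n ≃ n / 1
  ℕ→ℚ-≃ n = 0 , refl , Qᵘ.≃-reflexive (cong toℚᵘ (Q.normalize-coprime (coprime-sym (1-coprimeTo n))))

  *-≃ : ∀ {x y i j k l} → x ≃ i / j → y ≃ k / l → x *ℚ y ≃ i * k / (j * l)
  *-≃ {x} {y} {i} {k = k} (d , refl , x≃) (e , refl , y≃) =
    _ , refl , Qᵘ.≃-trans (Q.toℚᵘ-homo-* x y)
      (Qᵘ.≃-trans (Qᵘ.*-cong x≃ y≃) (Qᵘ.≃-reflexive (cong₂ mkℚᵘ (sym (ℤ.pos-* i k)) refl)))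

  ^ℚ-≃ : ∀ {x i j} e → x ≃ i / j → x ^ℚ e ≃ i ^ e / j ^ e
  ^ℚ-≃ zero    x≃i/j = 0 , refl , Qᵘ.≃-refl
  ^ℚ-≃ (suc e) x≃i/j = *-≃ x≃i/j (^ℚ-≃ e x≃i/j)

  ≤ℚ-≃⇔ : ∀ {x y i j k l} → x ≃ i / j → y ≃ k / l → x ≤ℚ y ⇔ i * l ≤ k * j
  ≤ℚ-≃⇔ {x} {y} {i} {k = k} (d , refl , x≃) (e , refl , y≃) = mk⇔
    (λ x≤y → from-ᵘ (Qᵘ.≤-respʳ-≃ y≃ (Qᵘ.≤-respˡ-≃ x≃ (Q.toℚᵘ-mono-≤ x≤y))))
    (λ i*l≤k*j → Q.toℚᵘ-cancel-≤ (Qᵘ.≤-respʳ-≃ (Qᵘ.≃-sym y≃) (Qᵘ.≤-respˡ-≃ (Qᵘ.≃-sym x≃) (to-ᵘ i*l≤k*j))))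
    where
    from-ᵘ : mkℚᵘ (+ i) d ≤ᵘ mkℚᵘ (+ k) e → i * suc e ≤ k * suc d
    from-ᵘ (*≤* i*l≤k*j) = ℤ.drop‿+≤+ (subst₂ _≤ℤ_ (sym (ℤ.pos-* i (suc e))) (sym (ℤ.pos-* k (suc d))) i*l≤k*j)
    to-ᵘ : i * suc e ≤ k * suc d → mkℚᵘ (+ i) d ≤ᵘ mkℚᵘ (+ k) e
    to-ᵘ i*l≤k*j = *≤* (subst₂ _≤ℤ_ (ℤ.pos-* i (suc e)) (ℤ.pos-* k (suc d)) (+≤+ i*l≤k*j))

  0<γ<1⇒≃a/b : ∀ γ → 0ℚ <ℚ γ → γ <ℚ 1ℚ → ∃[ a ] ∃[ b ] 0 < a × a < b × γ ≃ a / b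
  0<γ<1⇒≃a/b (mkℚ (+ zero)    d _) (*<* (+<+ ())) _
  0<γ<1⇒≃a/b (mkℚ -[1+ _ ]    d _) (*<* ())       _
  0<γ<1⇒≃a/b (mkℚ (+ suc a-1) d _) _ (*<* γ<1) =
    suc a-1 , suc d , s≤s z≤n ,
    subst₂ _<_ (ℕ.*-identityʳ (suc a-1)) (cong suc (ℕ.+-identityʳ d)) (ℤ.drop‿+<+ γ<1) ,
    d , refl , Qᵘ.≃-refl

  module _ {γ a b} (γ≃a/b : γ ≃ a / b) where

    ≤ℚ⇒≤ : ∀ {x y} → γ *ℚ ℕ→ℚ x ≤ℚ ℕ→ℚ y → a * x ≤ b * y
    ≤ℚ⇒≤ {x} {y} γx≤y = subst₂ _≤_ (ℕ.*-identityʳ (a * x)) (trans (cong (y *_) (ℕ.*-identityʳ b)) (ℕ.*-comm y b))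
      (Equivalence.to (≤ℚ-≃⇔ (*-≃ γ≃a/b (ℕ→ℚ-≃ x)) (ℕ→ℚ-≃ y)) γx≤y)

    ^-≤⇒≤ℚ : ∀ {e p x y} → a ^ e * x ^ p ≤ b ^ e * y ^ p → (γ ^ℚ e) *ℚ (ℕ→ℚ x ^ℚ p) ≤ℚ ℕ→ℚ y ^ℚ p
    ^-≤⇒≤ℚ {e} {p} {x} {y} ≤ = Equivalence.from
      (≤ℚ-≃⇔ (*-≃ (^ℚ-≃ e γ≃a/b) (^ℚ-≃ p (ℕ→ℚ-≃ x))) (^ℚ-≃ p (ℕ→ℚ-≃ y)))
      (subst₂ _≤_ (sym (trans (cong (a ^ e * x ^ p *_) (ℕ.^-zeroˡ p)) (ℕ.*-identityʳ _)))
                  (trans (ℕ.*-comm (b ^ e) (y ^ p)) (cong (y ^ p *_) (sym (trans (cong (b ^ e *_) (ℕ.^-zeroˡ p)) (ℕ.*-identityʳ _)))))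
                  ≤)

singleton-witness : ∀ {n p q t} (P : Subset n → Set) → 0 < n → q ≤ p → 2 ≤ t →
  ∃[ S ] n ^ q ≤ (2 * ∣ S ∣) ^ q * n ^ p × (∀ T → T ⊆ S → ∣ T ∣ ≡ t → P T)
singleton-witness {suc n} {p} {q} P _ q≤p 2≤t = ⁅ Fin.zero {n} ⁆ , size , λ T T⊆S ∣T∣≡t → contradiction
  (ℕ.≤-trans (ℕ.≤-reflexive (sym ∣T∣≡t)) (ℕ.≤-trans (p⊆q⇒∣p∣≤∣q∣ T⊆S) (ℕ.≤-reflexive (∣⁅x⁆∣≡1 (Fin.zero {n}))))) (ℕ.<⇒≱ 2≤t)
  where
  size : suc n ^ q ≤ (2 * ∣ ⁅ Fin.zero {n} ⁆ ∣) ^ q * suc n ^ p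
  size = subst (λ k → suc n ^ q ≤ (2 * k) ^ q * suc n ^ p) (sym (∣⁅x⁆∣≡1 (Fin.zero {n})))
    (ℕ.≤-trans (ℕ.^-monoʳ-≤ (suc n) q≤p) (ℕ.m≤n*m (suc n ^ p) (2 ^ q) {{ℕ.m^n≢0 2 q}}))

lemma2p6 : (m t : ℕ) → 1 ≤ m → 2 ≤ t →
  (γ : ℚ) → 0ℚ <ℚ γ → γ <ℚ 1ℚ →
  ∃[ C ] ((p q n : ℕ) → 1 ≤ p → 1 ≤ q → 2 ^ (C * q) ≤ n ^ p →
    (G : KPartite (suc m) n) →
    ((v : Fin n) (j : Fin m) →
      γ *ℚ ℕ→ℚ n ≤ℚ ℕ→ℚ ∣ N G ⁅ v ⁆ (inject₁ j) ∣) →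
    ∃[ S ] ((n ^ q ≤ (2 * ∣ S ∣) ^ q * n ^ p) ×
      ((T : Subset n) → T ⊆ S → ∣ T ∣ ≡ t → (j : Fin m) →
        (γ ^ℚ (2 * m * (t + 1) * q)) *ℚ (ℕ→ℚ n ^ℚ p)
          ≤ℚ ℕ→ℚ ∣ N G T (inject₁ j) ∣ ^ℚ p)))
lemma2p6 (suc m') (suc t') _ 2≤t γ 0<γ γ<1 with 0<γ<1⇒≃a/b γ 0<γ γ<1
... | a , b , a>0 , a<b , γ≃a/b = C , λ p q n p>0 _ 2^Cq≤n^p G deg →
  case p ℕ.<? q of λ
    { (no  p≮q) → singleton-witness _ (2^k≤n^p⇒n>0 (C * q) p>0 2^Cq≤n^p) (ℕ.≮⇒≥ p≮q) 2≤t
    ; (yes p<q) →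
      let open Parameters m' t' a>0 a<b p>0 p<q n hiding (C)
          s , affordable , fewBad = rounds 2^Cq≤n^p
          S , _ , shrunk , good = dependentRandomChoice-parts (a ^ r) (b ^ r) a b t' s
            (ℕ.m^n>0 b {{>-nonZero (ℕ.<-≤-trans a>0 (ℕ.<⇒≤ a<b))}} r) (2^k≤n^p⇒n>0 (C * q) p>0 2^Cq≤n^p) fewBad
            (λ j x y → adj G (lastPart (suc m')) x (inject₁ j) y) (λ j x → ≤ℚ⇒≤ γ≃a/b (deg x j)) ⊤
      in S , affordable⇒size {s} {∣ S ∣} affordable (subst (λ k → (a ^ s) ^ m * k ≤ (2 * b ^ s) ^ m * ∣ S ∣) (∣⊤∣≡n n) shrunk) ,
         λ T T⊆S ∣T∣≡t j → ^-≤⇒≤ℚ γ≃a/b {K * q} {p} {n} {∣ N G T (inject₁ j) ∣} (threshold (good j T⊆S ∣T∣≡t)) }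
  where
  C : ℕ
  C = suc m' * (1 + b * suc a)
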